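{- For all integers $m\ge 3$ and $k\ge 3$, the linear homogeneous equation in $m$ variables $$x_1+x_2+\dots+x_{m-1}=\left\lceil (m-1)^{\frac{k-1}{k-2}}\right\rceil x_m$$ is not $k$-regular. In particular, for all $m,k\ge 3$ there exists a linear homogeneous equation in $m$ variables that is not $k$-regular.
   Context: A linear equation $\mathcal{E}$ is $k$-regular if every coloring of the positive integers $\mathbb{N}$ with $k$ colors admits a monochromatic solution to $\mathcal{E}$ in positive integers (equivalently, the $k$-color Rado number $R_k(\mathcal{E})$, the least $n$ such that every $k$-coloring of $\{1,\dots,n\}$ has a monochromatic solution in $\{1,\dots,n\}$, is finite). -}

module Defs where

open import Data.Nat using (ℕ; zero; suc; _≤_; _^_; _≟_)
open import Data.Fin using (Fin; toℕ)
import Data.Fin as F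
open import Data.Integer as ℤ using (ℤ; +_; -_)
open import Data.Product using (Σ; ∃; _×_)
open import Relation.Binary.PropositionalEquality using (_≡_)
open import Relation.Nullary using (yes; no)

Σℤ : (m : ℕ) → (Fin m → ℤ) → ℤ
Σℤ zero    f = + 0
Σℤ (suc m) f = f F.zero ℤ.+ Σℤ m (λ i → f (F.suc i))

-- A linear homogeneous equation in m variables  a₁x₁ + … + aₘxₘ = 0
-- is given by its integer coefficient vector  a : Fin m → ℤ.
LinEq : ℕ → Set
LinEq m = Fin m → ℤ

IsPosSolution : {m : ℕ} → LinEq m → (Fin m → ℕ) → Set
IsPosSolution {m} a x =
  (∀ i → 1 ≤ x i) × (Σℤ m (λ i → a i ℤ.* (+ x i)) ≡ + 0)

-- A k-colouring of the positive integers (the value at 0 is irrelevant).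
Colouring : ℕ → Set
Colouring k = ℕ → Fin k

Regular : (k : ℕ) {m : ℕ} → LinEq m → Set
Regular k {m} a =
  (χ : Colouring k) →
  Σ (Fin m → ℕ) λ x → IsPosSolution a x × Σ (Fin k) λ j → ∀ i → χ (x i) ≡ j

-- c = ⌈ a^(p/q) ⌉  for q ≥ 1, characterised without reals:
-- c is the least natural number with  a^p ≤ c^q  (since c ≥ a^(p/q) ⇔ c^q ≥ a^p).
IsCeilPow : (a p q c : ℕ) → Set
IsCeilPow a p q c = (a ^ p ≤ c ^ q) × (∀ d → a ^ p ≤ d ^ q → c ≤ d)

eqCoeffs : (m c : ℕ) → LinEq m
eqCoeffs m c i with suc (toℕ i) ≟ m
... | yes _ = - (+ c)
... | no  _ = + 1

module Submission where

-- Write n = m - 1 and r = c/n > 1, and colour x by its level ⌊log_r x⌋ modulo k. Take a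
-- monochromatic solution y₁ + … + yₙ = c Y. If the level of some yᵢ exceeds that of Y, it
-- does so by at least k, whence yᵢ > r^(k-1) Y ≥ c Y because c^(k-2) ≥ n^(k-1); this
-- contradicts yᵢ ≤ Σ yᵢ = c Y. Otherwise every yᵢ < r Y, i.e. n yᵢ < c Y, and summing gives
-- n c Y < n c Y.

open import Defs
open import Data.Nat using (ℕ; _≤_; _∸_)
open import Data.Product using (Σ; _×_)
open import Relation.Nullary using (¬_)

open import Data.Nat.Base using (zero; suc; _+_; _*_; _^_; _<_; _%_; NonZero; >-nonZero; z≤n; s≤s)
open import Data.Nat.Properties
open import Algebra.Properties.CommutativeSemigroup *-commutativeSemigroup
  using (x∙yz≈y∙xz; x∙yz≈yx∙z; xy∙z≈y∙xz)
open import Data.Nat.DivMod using (_/_; _mod_; m≡m%n+[m/n]*n; [m+n]%n≡m%n; m/n≡1+[m∸n]/n; m%n<n)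
open import Data.Nat.Tactic.RingSolver using (solve-∀)
open import Data.Fin.Base as Fin using (Fin; toℕ; inject₁; fromℕ)
open import Data.Fin.Properties using (toℕ-fromℕ; toℕ-fromℕ<; toℕ-inject₁; toℕ<n)
open import Data.Vec.Functional using (Vector; head; tail; init; last; map)
open import Data.Integer.Base as ℤ using (ℤ; +_; -_)
import Data.Integer.Properties as ℤ
import Algebra.Properties.Semiring.Sum as SemiringSum
open import Data.Product using (_,_; proj₁; proj₂)
open import Function.Base using (_∘_)
open import Relation.Nullary using (yes; no; contradiction)
open import Relation.Unary using (Pred; Decidable)
open import Relation.Binary.PropositionalEquality

module ℕΣ = SemiringSum +-*-semiring
module ℤΣ = SemiringSum ℤ.+-*-semiring

module _ {p} {P : Pred ℕ p} (P? : Decidable P) where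

  climb : (fuel start : ℕ) → ℕ
  climb zero    j = j
  climb (suc f) j with P? (suc j)
  ... | yes _ = climb f (suc j)
  ... | no  _ = j

  climb-last : ∀ f j → P j → ¬ P (j + f) → P (climb f j) × ¬ P (suc (climb f j))
  climb-last zero    j Pj ¬P = contradiction (subst P (sym (+-identityʳ j)) Pj) ¬P
  climb-last (suc f) j Pj ¬P with P? (suc j)
  ... | yes Psj = climb-last f (suc j) Psj (¬P ∘ subst P (sym (+-suc j f)))
  ... | no ¬Psj = Pj , ¬Psj

bernoulli : ∀ n j → n ^ j * (n + j) ≤ n * suc n ^ j
bernoulli n zero    = ≤-reflexive (base n)
  where
  base : ∀ n → 1 * (n + 0) ≡ n * 1
  base = solve-∀
bernoulli n (suc j) = begin
  n ^ suc j * (n + suc j)             ≤⟨ m≤m+n _ (n ^ j * j) ⟩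
  n ^ suc j * (n + suc j) + n ^ j * j ≡⟨ expand n j (n ^ j) ⟩
  suc n * (n ^ j * (n + j))           ≤⟨ *-monoʳ-≤ (suc n) (bernoulli n j) ⟩
  suc n * (n * suc n ^ j)             ≡⟨ x∙yz≈y∙xz (suc n) n (suc n ^ j) ⟩
  n * suc n ^ suc j                   ∎
  where
  open ≤-Reasoning
  expand : ∀ n j p → n * p * (n + suc j) + p * j ≡ suc n * (p * (n + j))
  expand = solve-∀

n^[n*x]*x<[1+n]^[n*x] : ∀ n x .{{_ : NonZero n}} → n ^ (n * x) * x < suc n ^ (n * x)
n^[n*x]*x<[1+n]^[n*x] n x = begin-strict
  n ^ F * x     <⟨ *-monoʳ-< (n ^ F) {{m^n≢0 n F}} (n<1+n x) ⟩
  n ^ F * suc x ≤⟨ *-cancelˡ-≤ n (begin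
    n * (n ^ F * suc x) ≡⟨ regroup n x (n ^ F) ⟩
    n ^ F * (n + F)     ≤⟨ bernoulli n F ⟩
    n * suc n ^ F       ∎) ⟩
  suc n ^ F     ∎
  where
  open ≤-Reasoning
  F = n * x
  regroup : ∀ n x p → n * (p * suc x) ≡ p * (n + n * x)
  regroup = solve-∀

-- With r = c/n: Y ≥ r^b and y < r^(d+b) give y < r^d Y; Y < r^b and y ≥ r^(d+b) give y > r^d Y.
ratio-< : ∀ {n c} b d {y Y} → c ^ b ≤ n ^ b * Y → n ^ (d + b) * y < c ^ (d + b) →
          n ^ d * y < c ^ d * Y
ratio-< {n} {c} b d {y} {Y} hY hy = *-cancelˡ-< (n ^ b) _ _ (begin-strict
  n ^ b * (n ^ d * y) ≡⟨ x∙yz≈yx∙z (n ^ b) (n ^ d) y ⟩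
  n ^ d * n ^ b * y   ≡⟨ cong (_* y) (^-distribˡ-+-* n d b) ⟨
  n ^ (d + b) * y     <⟨ hy ⟩
  c ^ (d + b)         ≡⟨ ^-distribˡ-+-* c d b ⟩
  c ^ d * c ^ b       ≤⟨ *-monoʳ-≤ (c ^ d) hY ⟩
  c ^ d * (n ^ b * Y) ≡⟨ x∙yz≈y∙xz (c ^ d) (n ^ b) Y ⟩
  n ^ b * (c ^ d * Y) ∎)
  where open ≤-Reasoning

ratio-> : ∀ {n c} .{{_ : NonZero c}} b d {y Y} → n ^ b * Y < c ^ b →
          c ^ (d + b) ≤ n ^ (d + b) * y → c ^ d * Y < n ^ d * y
ratio-> {n} {c} b d {y} {Y} hY hy = *-cancelˡ-< (n ^ b) _ _ (begin-strict
  n ^ b * (c ^ d * Y) ≡⟨ x∙yz≈y∙xz (n ^ b) (c ^ d) Y ⟩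
  c ^ d * (n ^ b * Y) <⟨ *-monoʳ-< (c ^ d) {{m^n≢0 c d}} hY ⟩
  c ^ d * c ^ b       ≡⟨ ^-distribˡ-+-* c d b ⟨
  c ^ (d + b)         ≤⟨ hy ⟩
  n ^ (d + b) * y     ≡⟨ cong (_* y) (^-distribˡ-+-* n d b) ⟩
  n ^ d * n ^ b * y   ≡⟨ xy∙z≈y∙xz (n ^ d) (n ^ b) y ⟩
  n ^ b * (n ^ d * y) ∎)
  where open ≤-Reasoning

n^a*y<c^a⇒n^[a+o]*y<c^[a+o] : ∀ {n c} .{{_ : NonZero c}} a o {y} → n ≤ c →
                               n ^ a * y < c ^ a → n ^ (a + o) * y < c ^ (a + o)
n^a*y<c^a⇒n^[a+o]*y<c^[a+o] {n} {c} a o {y} n≤c h = begin-strict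
  n ^ (a + o) * y       ≡⟨ cong (_* y) (^-distribˡ-+-* n a o) ⟩
  n ^ a * n ^ o * y     ≡⟨ xy∙z≈y∙xz (n ^ a) (n ^ o) y ⟩
  n ^ o * (n ^ a * y)   ≤⟨ *-monoˡ-≤ (n ^ a * y) (^-monoˡ-≤ o n≤c) ⟩
  c ^ o * (n ^ a * y)   <⟨ *-monoʳ-< (c ^ o) {{m^n≢0 c o}} h ⟩
  c ^ o * c ^ a         ≡⟨ *-comm (c ^ o) (c ^ a) ⟩
  c ^ a * c ^ o         ≡⟨ ^-distribˡ-+-* c a o ⟨
  c ^ (a + o)           ∎
  where open ≤-Reasoning

c*n^[1+K+t]≤c^[1+K+t] : ∀ {n c} K t → n ≤ c → n ^ suc K ≤ c ^ K →
                        c * n ^ (suc K + t) ≤ c ^ (suc K + t)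
c*n^[1+K+t]≤c^[1+K+t] {n} {c} K t n≤c h = *-monoʳ-≤ c (begin
  n ^ (suc K + t)       ≡⟨ ^-distribˡ-+-* n (suc K) t ⟩
  n ^ suc K * n ^ t     ≤⟨ *-mono-≤ h (^-monoˡ-≤ t n≤c) ⟩
  c ^ K * c ^ t         ≡⟨ ^-distribˡ-+-* c K t ⟨
  c ^ (K + t)           ∎)
  where open ≤-Reasoning

n^[1+K]≤c^K⇒n<c : ∀ {n c} K → 2 ≤ n → n ^ suc K ≤ c ^ K → n < c
n^[1+K]≤c^K⇒n<c {n} K 2≤n hK =
  ≰⇒> (λ c≤n → <⇒≱ (≤-<-trans (^-monoˡ-≤ K c≤n) (^-monoʳ-< n 2≤n (n<1+n K))) hK)

m%k≡n%k⇒m/k≤n/k⇒m≤n : ∀ {m n} k .{{_ : NonZero k}} → m % k ≡ n % k → m / k ≤ n / k → m ≤ n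
m%k≡n%k⇒m/k≤n/k⇒m≤n {m} {n} k m%k≡n%k m/k≤n/k = begin
  m                 ≡⟨ m≡m%n+[m/n]*n m k ⟩
  m % k + m / k * k ≡⟨ cong (_+ m / k * k) m%k≡n%k ⟩
  n % k + m / k * k ≤⟨ +-monoʳ-≤ (n % k) (*-monoˡ-≤ k m/k≤n/k) ⟩
  n % k + n / k * k ≡⟨ m≡m%n+[m/n]*n n k ⟨
  n                 ∎
  where open ≤-Reasoning

m%k≡n%k⇒m<n⇒m+k≤n : ∀ {m n} k .{{_ : NonZero k}} → m % k ≡ n % k → m < n → m + k ≤ n
m%k≡n%k⇒m<n⇒m+k≤n {m} {n} k m%k≡n%k m<n =
  m%k≡n%k⇒m/k≤n/k⇒m≤n k (trans ([m+n]%n≡m%n m k) m%k≡n%k) (begin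
    (m + k) / k           ≡⟨ m/n≡1+[m∸n]/n (m≤n+m k m) ⟩
    suc ((m + k ∸ k) / k) ≡⟨ cong (λ i → suc (i / k)) (m+n∸n≡m m k) ⟩
    suc (m / k)           ≤⟨ m/k<n/k ⟩
    n / k                 ∎)
  where
  open ≤-Reasoning
  m/k<n/k : m / k < n / k
  m/k<n/k = ≰⇒> (<⇒≱ m<n ∘ m%k≡n%k⇒m/k≤n/k⇒m≤n k (sym m%k≡n%k))

mod≡mod⇒%≡% : ∀ {m n} k .{{_ : NonZero k}} → m mod k ≡ n mod k → m % k ≡ n % k
mod≡mod⇒%≡% {m} {n} k eq = begin
  m % k         ≡⟨ toℕ-fromℕ< (m%n<n m k) ⟨
  toℕ (m mod k) ≡⟨ cong toℕ eq ⟩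
  toℕ (n mod k) ≡⟨ toℕ-fromℕ< (m%n<n n k) ⟩
  n % k         ∎
  where open ≡-Reasoning

-- level n c x is the largest j with (c/n)^j ≤ x; the search fuel n * x suffices because
-- (1 + 1/n)^(n x) ≥ 1 + x by Bernoulli's inequality.
level : ℕ → ℕ → ℕ → ℕ
level n c x = climb (λ j → c ^ j ≤? n ^ j * x) (n * x) 0

module Level {n c : ℕ} .{{_ : NonZero n}} (n<c : n < c) where

  instance
    c≢0 : NonZero c
    c≢0 = >-nonZero (≤-trans (s≤s z≤n) n<c)

  private
    level-spec : ∀ {x} → 1 ≤ x →
      (c ^ level n c x ≤ n ^ level n c x * x) ×
      ¬ (c ^ suc (level n c x) ≤ n ^ suc (level n c x) * x)
    level-spec {x} 1≤x = climb-last (λ j → c ^ j ≤? n ^ j * x) (n * x) 0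
      (subst (1 ≤_) (sym (*-identityˡ x)) 1≤x)
      (<⇒≱ (<-≤-trans (n^[n*x]*x<[1+n]^[n*x] n x) (^-monoˡ-≤ (n * x) n<c)))

  level-lower : ∀ {x} → 1 ≤ x → c ^ level n c x ≤ n ^ level n c x * x
  level-lower = proj₁ ∘ level-spec

  level-upper : ∀ {x} → 1 ≤ x → n ^ suc (level n c x) * x < c ^ suc (level n c x)
  level-upper = ≰⇒> ∘ proj₂ ∘ level-spec

  level-≤⇒n*y<c*Y : ∀ {y Y} → 1 ≤ y → 1 ≤ Y → level n c y ≤ level n c Y → n * y < c * Y
  level-≤⇒n*y<c*Y {y} {Y} 1≤y 1≤Y ly≤lY with m≤n⇒∃[o]m+o≡n ly≤lY
  ... | o , ly+o≡lY = subst₂ (λ a b → a * y < b * Y) (^-identityʳ n) (^-identityʳ c)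
    (ratio-< (level n c Y) 1 (level-lower 1≤Y) y-below)
    where
    y-below : n ^ suc (level n c Y) * y < c ^ suc (level n c Y)
    y-below = subst (λ e → n ^ e * y < c ^ e) (cong suc ly+o≡lY)
      (n^a*y<c^a⇒n^[a+o]*y<c^[a+o] (suc (level n c y)) o (<⇒≤ n<c) (level-upper 1≤y))

  level-gap⇒c*Y<y : ∀ K {y Y} → n ^ suc K ≤ c ^ K → 1 ≤ y → 1 ≤ Y →
                    level n c Y + suc (suc K) ≤ level n c y → c * Y < y
  level-gap⇒c*Y<y K {y} {Y} hK 1≤y 1≤Y gap with m≤n⇒∃[o]m+o≡n gap
  ... | t , lY+k+t≡ly = *-cancelˡ-< (n ^ d) _ _ (begin-strict
    n ^ d * (c * Y) ≡⟨ x∙yz≈yx∙z (n ^ d) c Y ⟩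
    c * n ^ d * Y   ≤⟨ *-monoˡ-≤ Y (c*n^[1+K+t]≤c^[1+K+t] K t (<⇒≤ n<c) hK) ⟩
    c ^ d * Y       <⟨ ratio-> {n} {c} (suc (level n c Y)) d (level-upper 1≤Y) y-above ⟩
    n ^ d * y       ∎)
    where
    open ≤-Reasoning
    d = suc K + t
    rearrange : ∀ K t l → suc K + t + suc l ≡ l + suc (suc K) + t
    rearrange = solve-∀
    y-above : c ^ (d + suc (level n c Y)) ≤ n ^ (d + suc (level n c Y)) * y
    y-above = subst (λ e → c ^ e ≤ n ^ e * y) (sym (trans (rearrange K t (level n c Y)) lY+k+t≡ly))
      (level-lower 1≤y)

sum-< : ∀ {t} (f : Vector ℕ t) {Z} → 1 ≤ t → (∀ i → f i < Z) → ℕΣ.sum f < t * Z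
sum-< {suc zero}    f _ f<Z = +-monoˡ-< 0 (f<Z Fin.zero)
sum-< {suc (suc t)} f _ f<Z = +-mono-< (f<Z Fin.zero) (sum-< (tail f) (s≤s z≤n) (f<Z ∘ Fin.suc))

term≤sum : ∀ {t} (f : Vector ℕ (suc t)) i → f i ≤ ℕΣ.sum f
term≤sum f i = ≤-trans (m≤m+n (f i) _) (≤-reflexive (sym (ℕΣ.sum-remove {i = i} f)))

Σℤ≡sum : ∀ m (f : Vector ℤ m) → Σℤ m f ≡ ℤΣ.sum f
Σℤ≡sum zero    f = refl
Σℤ≡sum (suc m) f = cong (ℤ._+_ (head f)) (Σℤ≡sum m (tail f))

sum-pos : ∀ {m} (f : Vector ℕ m) → ℤΣ.sum (+_ ∘ f) ≡ + ℕΣ.sum f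
sum-pos {zero}  f = refl
sum-pos {suc m} f = cong (ℤ._+_ (+ head f)) (sum-pos (tail f))

eqCoeffs-inject₁ : ∀ {n} c (i : Fin n) → eqCoeffs (suc n) c (inject₁ i) ≡ + 1
eqCoeffs-inject₁ {n} c i with suc (toℕ (inject₁ i)) ≟ suc n
... | no  _ = refl
... | yes e = contradiction (trans (sym (toℕ-inject₁ i)) (suc-injective e)) (<⇒≢ (toℕ<n i))

eqCoeffs-last : ∀ n c → eqCoeffs (suc n) c (fromℕ n) ≡ - (+ c)
eqCoeffs-last n c with suc (toℕ (fromℕ n)) ≟ suc n
... | yes _  = refl
... | no  ≢n = contradiction (cong suc (toℕ-fromℕ n)) ≢n

solution⇒sum≡c*last : ∀ {n c} (x : Vector ℕ (suc n)) →
  Σℤ (suc n) (λ i → eqCoeffs (suc n) c i ℤ.* + x i) ≡ + 0 → ℕΣ.sum (init x) ≡ c * last x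
solution⇒sum≡c*last {n} {c} x solution = ℤ.+-injective (ℤ.i-j≡0⇒i≡j _ _ (begin
  + ℕΣ.sum (init x) ℤ.- + (c * last x)
    ≡⟨ cong₂ ℤ._+_ (sum-pos (init x)) (sym (trans (cong -_ (ℤ.pos-* c (last x))) (ℤ.neg-distribˡ-* (+ c) _))) ⟨
  ℤΣ.sum (+_ ∘ init x) ℤ.+ - (+ c) ℤ.* + last x
    ≡⟨ cong₂ ℤ._+_ (ℤΣ.sum-cong-≗ coefficient-one) (cong (ℤ._* + last x) (eqCoeffs-last n c)) ⟨
  ℤΣ.sum (init g) ℤ.+ last g
    ≡⟨ ℤΣ.sum-init-last g ⟨
  ℤΣ.sum g
    ≡⟨ Σℤ≡sum (suc n) g ⟨
  Σℤ (suc n) g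
    ≡⟨ solution ⟩
  + 0 ∎))
  where
  open ≡-Reasoning
  g : Vector ℤ (suc n)
  g i = eqCoeffs (suc n) c i ℤ.* + x i
  coefficient-one : ∀ i → init g i ≡ + init x i
  coefficient-one i = trans (cong (ℤ._* + init x i) (eqCoeffs-inject₁ c i)) (ℤ.*-identityˡ (+ init x i))

eqCoeffs-nonRegular : ∀ {n c} K → 2 ≤ n → n ^ suc K ≤ c ^ K →
                      ¬ Regular (suc (suc K)) (eqCoeffs (suc n) c)
eqCoeffs-nonRegular {n@(suc _)} {c} K 2≤n hK regular
  with regular (λ x → level n c x mod suc (suc K))
... | x , (positive , solution) , _ , monochromatic =
  <-irrefl (cong (n *_) Σy≡c*Y) (begin-strict
    n * ℕΣ.sum y          ≡⟨ ℕΣ.*-distribˡ-sum n y ⟩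
    ℕΣ.sum (map (n *_) y) <⟨ sum-< (map (n *_) y) (<⇒≤ 2≤n) n*y<c*Y ⟩
    n * (c * Y)           ∎)
  where
  open ≤-Reasoning
  open Level (n^[1+K]≤c^K⇒n<c K 2≤n hK)
  k = suc (suc K)
  y = init x
  Y = last x
  Σy≡c*Y : ℕΣ.sum y ≡ c * Y
  Σy≡c*Y = solution⇒sum≡c*last x solution
  same-level-mod : ∀ i → level n c Y % k ≡ level n c (y i) % k
  same-level-mod i = mod≡mod⇒%≡% {level n c Y} {level n c (y i)} k
    (trans (monochromatic (fromℕ n)) (sym (monochromatic (inject₁ i))))
  n*y<c*Y : ∀ i → n * y i < c * Y
  n*y<c*Y i with level n c (y i) ≤? level n c Y
  ... | yes ly≤lY = level-≤⇒n*y<c*Y (positive _) (positive _) ly≤lY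
  ... | no  ly≰lY = contradiction
    (level-gap⇒c*Y<y K hK (positive _) (positive _)
      (m%k≡n%k⇒m<n⇒m+k≤n k (same-level-mod i) (≰⇒> ly≰lY)))
    (≤⇒≯ (≤-trans (term≤sum y i) (≤-reflexive Σy≡c*Y)))

theorem6 : (m k : ℕ) → 3 ≤ m → 3 ≤ k →
    ((c : ℕ) → IsCeilPow (m ∸ 1) (k ∸ 1) (k ∸ 2) c → ¬ Regular k (eqCoeffs m c))
    × Σ (LinEq m) (λ a → ¬ Regular k a)
theorem6 (suc n) (suc (suc K)) (s≤s 2≤n@(s≤s _)) (s≤s (s≤s (s≤s _))) =
  (λ c c-bound → eqCoeffs-nonRegular K 2≤n (proj₁ c-bound)) ,
  (eqCoeffs (suc n) (n ^ 2) , eqCoeffs-nonRegular K 2≤n n^[1+K]≤[n^2]^K)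
  where
  n^[1+K]≤[n^2]^K : n ^ suc K ≤ (n ^ 2) ^ K
  n^[1+K]≤[n^2]^K = begin
    n ^ suc K   ≤⟨ ^-monoʳ-≤ n (≤-trans (≤-reflexive (+-comm 1 K)) (+-monoʳ-≤ K (s≤s z≤n))) ⟩
    n ^ (2 * K) ≡⟨ ^-*-assoc n 2 K ⟨
    (n ^ 2) ^ K ∎
    where open ≤-Reasoning
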